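{- Let $\mathcal{Y}$ be a $k$-element set. Let $A$ be a set disjoint from $\mathcal{Y}$ such that $|A|\ge k\cdot\max\{\log k+\log\log k,\,11\}$. Then there is a $\mathcal{Y}$-shrub in $\mathcal{Q}(A\cup\mathcal{Y})$.
   Context: $\log$ is the logarithm to base 2. $\mathcal{Q}(\mathcal{S})$ is the Boolean lattice of all subsets of $\mathcal{S}$ ordered by inclusion. An ordered subset of $\mathcal{Y}$ is a (possibly empty) subset with a linear order on it; $\underline{S}$ is its underlying set. $T\le_{\mathcal{O}}S$ means $T$ is a prefix of $S$ (the first $|T|$ elements of $S$ in $S$'s order). The factorial tree $\mathcal{O}(\mathcal{Y})$ is the poset of all ordered subsets of $\mathcal{Y}$ under $\le_{\mathcal{O}}$. A $\mathcal{Y}$-shrub in $\mathcal{Q}(A\cup\mathcal{Y})$ is the image of an embedding $\tau:\mathcal{O}(\mathcal{Y})\to\mathcal{Q}(A\cup\mathcal{Y})$ (injective with $S\le_{\mathcal{O}}T$ iff $\tau(S)\subseteq\tau(T)$) satisfying $\tau(S)\cap\mathcal{Y}=\underline{S}$ for all $S$. -}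

module Defs where

open import Data.Nat using (ℕ; suc; _+_; _*_; _^_; _<_; _≤_)
open import Data.Fin using (Fin)
open import Data.Fin.Subset using (Subset; ⁅_⁆; _∪_; ⊥; _⊆_)
open import Data.List using (List; []; _∷_; _++_; foldr)
open import Data.List.Relation.Unary.Unique.Propositional using (Unique)
open import Data.Product using (Σ; ∃; _×_; _,_; proj₁; proj₂)
open import Relation.Binary.PropositionalEquality using (_≡_)
open import Function.Bundles using (_⇔_)

-- The k-element set 𝒴 is modelled as Fin k, the set A as Fin a.

-- Ordered subsets of Fin k: duplicate-free lists (list order = linear order).
OrdSub : ℕ → Set
OrdSub k = Σ (List (Fin k)) Unique

underlying : ∀ {k} → List (Fin k) → Subset k
underlying = foldr (λ x s → ⁅ x ⁆ ∪ s) ⊥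

_≤O_ : ∀ {k} → OrdSub k → OrdSub k → Set
_≤O_ {k} T S = ∃ λ (U : List (Fin k)) → proj₁ T ++ U ≡ proj₁ S

-- Subsets of A ∪ 𝒴 (disjoint union) = pairs (part in A, part in 𝒴),
-- ordered by componentwise inclusion (this is the Boolean lattice 𝒬(A ∪ 𝒴)).
QSet : ℕ → ℕ → Set
QSet a k = Subset a × Subset k

_⊆Q_ : ∀ {a k} → QSet a k → QSet a k → Set
X ⊆Q Y = (proj₁ X ⊆ proj₁ Y) × (proj₂ X ⊆ proj₂ Y)

-- A 𝒴-shrub in 𝒬(A ∪ 𝒴): an embedding τ of the factorial tree 𝒪(𝒴)
-- with τ(S) ∩ 𝒴 = underlying S.
IsShrubEmbedding : ∀ a k → (OrdSub k → QSet a k) → Set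
IsShrubEmbedding a k τ =
  (∀ S T → τ S ≡ τ T → proj₁ S ≡ proj₁ T)
  × (∀ S T → (S ≤O T) ⇔ (τ S ⊆Q τ T))
  × (∀ S → proj₂ (τ S) ≡ underlying (proj₁ S))

HasShrub : ℕ → ℕ → Set
HasShrub a k = ∃ λ (τ : OrdSub k → QSet a k) → IsShrubEmbedding a k τ

-- The real-number condition  a ≥ k·(log k + log log k)  (log base 2),
-- stated without reals. With t* = 2^(a/k) it says k·log k ≤ t*, i.e.
-- k^k ≤ 2^(t*). Equivalently: every nonnegative rational q = p/r with
-- 2^q < k^k (i.e. 2^p < k^(k·r)) satisfies q < t*, i.e. q^k < 2^a, i.e.
-- p^k < 2^a · r^k.  For k ≤ 1 (where log log k is undefined / -∞) the
-- condition is vacuous, so only the bound a ≥ 11k remains.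
LogLogBound : ℕ → ℕ → Set
LogLogBound k a = ∀ (p r : ℕ) → 0 < r → 2 ^ p < k ^ (k * r) → p ^ k < 2 ^ a * r ^ k

SizeHyp : ℕ → ℕ → Set
SizeHyp k a = LogLogBound k a × (k * 11 ≤ a)

-- Let b = ⌊a/k⌋ and D = C(b, ⌊b/2⌋). If k ≤ D, the ⌊b/2⌋-subsets of a b-set provide an antichain
-- α : 𝒴 → 𝒬([b]). Split A into k blocks of size b (plus a remainder) and send an ordered set
-- S = (y₁, …, y_m) to τ(S), whose i-th block is α(y_i) for i ≤ m and empty for i > m, and whose
-- 𝒴-part is {y₁, …, y_m}. Prefixes go to subsets. Conversely, if τ(S) ⊆ τ(T) then the blocks of S
-- and T agree one by one because α is an antichain, while inclusion on 𝒴 prevents T from being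
-- shorter than S.
-- It remains to show k ≤ D. Otherwise 2^(2^(b+1)) < (D+1)^(D+1) ≤ k^k, and the log log hypothesis
-- turns this into (b+1)·k < a, contradicting b = ⌊a/k⌋. The first inequality holds for all b ≥ 11:
-- for b ≥ 130 it follows from the estimate 16ⁿ ≤ C(2n,n)²·(4n+1), for smaller b by evaluation.

module Submission where

open import Defs
open import Data.Nat
open import Data.Nat.Properties
open import Data.Nat.Combinatorics using (_C_; nCk+nC[k+1]≡[n+1]C[k+1]; nCk≡nC[n∸k]; nC1≡n)
open import Data.Nat.DivMod using (_/_; m/n*n≤m; m*n/n≡m; /-monoˡ-≤; m≡m%n+[m/n]*n; m%n<n)
open import Data.Nat.Tactic.RingSolver using (solve-∀)
open import Data.Fin using (Fin; zero; suc; splitAt; join; inject≤; toℕ)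
open import Data.Fin.Properties using (join-splitAt; inject≤-injective; pigeonhole)
open import Data.Fin.Subset as Subset using (Subset; _⊆_; ∣_∣; inside; outside; ⁅_⁆; ⊥)
open import Data.Fin.Subset.Properties
  using (drop-∷-⊆; ∣⊥∣≡0; p⊆q⇒∣p∣≤∣q∣; ⊥⊆; ∉⊥; x∈⁅x⁆; x∈⁅y⁆⇒x≡y; x∈p∪q⁻; p⊆p∪q; q⊆p∪q; ⊆-refl)
open import Data.Vec using ([]; _∷_; _++_)
open import Data.Vec.Base using (here; there)
open import Data.Vec.Properties using (∷-injectiveˡ; ∷-injectiveʳ)
open import Data.List as List using (List; []; _∷_; length; lookup; upTo)
open import Data.List.Properties using (++-identityʳ; ++-identityʳ-unique; ++-conicalˡ; ++-assoc)
open import Data.List.Membership.Propositional using (_∈_)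
open import Data.List.Membership.Propositional.Properties using (∈-lookup; ∈-upTo⁺)
open import Data.List.Relation.Unary.Any using (here; there)
open import Data.List.Relation.Unary.All as All using (All; all?)
open import Data.List.Relation.Unary.AllPairs using (_∷_)
open import Data.List.Relation.Unary.Unique.Propositional using (Unique)
import Data.List.Relation.Binary.Subset.Propositional as List
open import Data.List.Relation.Binary.Subset.Propositional.Properties using (xs⊆xs++ys)
open import Data.Sum using (_⊎_; inj₁; inj₂; [_,_]′)
open import Data.Product using (Σ; ∃; _×_; _,_; proj₁; proj₂)
open import Data.Unit using (tt)
open import Function using (_∘_)
open import Function.Bundles using (mk⇔)
open import Relation.Binary.PropositionalEquality
open import Relation.Binary.PropositionalEquality.Properties using (subst-injective)
open import Relation.Nullary using (Dec; yes; no; contradiction)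
open import Relation.Nullary.Decidable using (toWitness; _×-dec_; _⊎-dec_; _→-dec_)

[k+1]*[n+1]C[k+1]≡[n+1]*nCk : ∀ n k → suc k * (suc n C suc k) ≡ suc n * (n C k)
[k+1]*[n+1]C[k+1]≡[n+1]*nCk zero    zero    = refl
[k+1]*[n+1]C[k+1]≡[n+1]*nCk zero    (suc k) = *-zeroʳ (2 + k)
[k+1]*[n+1]C[k+1]≡[n+1]*nCk (suc n) zero    =
  trans (+-identityʳ _) (trans (nC1≡n (2 + n)) (sym (*-identityʳ (2 + n))))
[k+1]*[n+1]C[k+1]≡[n+1]*nCk (suc n) (suc k) = begin
  (2 + k) * ((2 + n) C (2 + k))
    ≡⟨ cong ((2 + k) *_) (nCk+nC[k+1]≡[n+1]C[k+1] (1 + n) (1 + k)) ⟨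
  (2 + k) * (c₁ + c₂)
    ≡⟨ distrib k c₁ c₂ ⟩
  c₁ + ((1 + k) * c₁ + (2 + k) * c₂)
    ≡⟨ cong₂ (λ u v → c₁ + (u + v)) ([k+1]*[n+1]C[k+1]≡[n+1]*nCk n k)
                                    ([k+1]*[n+1]C[k+1]≡[n+1]*nCk n (suc k)) ⟩
  c₁ + ((1 + n) * (n C k) + (1 + n) * (n C (1 + k)))
    ≡⟨ cong (c₁ +_) (*-distribˡ-+ (1 + n) (n C k) (n C (1 + k))) ⟨
  c₁ + (1 + n) * (n C k + n C (1 + k))
    ≡⟨ cong (λ c → c₁ + (1 + n) * c) (nCk+nC[k+1]≡[n+1]C[k+1] n k) ⟩
  (2 + n) * c₁
    ∎
  where
  open ≡-Reasoning
  c₁ = (1 + n) C (1 + k)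
  c₂ = (1 + n) C (2 + k)
  distrib : ∀ k x y → (2 + k) * (x + y) ≡ x + ((1 + k) * x + (2 + k) * y)
  distrib = solve-∀

central : ℕ → ℕ
central n = (n + n) C n

[n+1]*central[n+1]≡2*[2n+1]*central[n] : ∀ n → suc n * central (suc n) ≡ 2 * suc (n + n) * central n
[n+1]*central[n+1]≡2*[2n+1]*central[n] n = *-cancelˡ-≡ _ _ (suc n) (begin
  (1 + n) * ((1 + n) * central (1 + n))
    ≡⟨ cong (λ m → (1 + n) * ((1 + n) * (m C (1 + n)))) (+-suc (1 + n) n) ⟩
  (1 + n) * ((1 + n) * ((2 + (n + n)) C (1 + n)))
    ≡⟨ cong ((1 + n) *_) ([k+1]*[n+1]C[k+1]≡[n+1]*nCk (1 + (n + n)) n) ⟩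
  (1 + n) * ((2 + (n + n)) * ((1 + (n + n)) C n))
    ≡⟨ cong (λ c → (1 + n) * ((2 + (n + n)) * c)) symmetry ⟩
  (1 + n) * ((2 + (n + n)) * ((1 + (n + n)) C (1 + n)))
    ≡⟨ swap n ((1 + (n + n)) C (1 + n)) ⟩
  (2 + (n + n)) * ((1 + n) * ((1 + (n + n)) C (1 + n)))
    ≡⟨ cong ((2 + (n + n)) *_) ([k+1]*[n+1]C[k+1]≡[n+1]*nCk (n + n) n) ⟩
  (2 + (n + n)) * ((1 + (n + n)) * central n)
    ≡⟨ regroup n (central n) ⟩
  (1 + n) * (2 * (1 + (n + n)) * central n)
    ∎)
  where
  open ≡-Reasoning
  symmetry : (1 + (n + n)) C n ≡ (1 + (n + n)) C (1 + n)
  symmetry = trans (nCk≡nC[n∸k] (m≤n⇒m≤1+n (m≤m+n n n)))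
                   (cong ((1 + (n + n)) C_) (trans (cong (_∸ n) (sym (+-suc n n))) (m+n∸m≡n n (1 + n))))
  swap : ∀ n x → (1 + n) * ((2 + (n + n)) * x) ≡ (2 + (n + n)) * ((1 + n) * x)
  swap = solve-∀
  regroup : ∀ n x → (2 + (n + n)) * ((1 + (n + n)) * x) ≡ (1 + n) * (2 * (1 + (n + n)) * x)
  regroup = solve-∀

2^n≤central : ∀ n → 2 ^ n ≤ central n
2^n≤central zero    = ≤-refl
2^n≤central (suc n) = *-cancelˡ-≤ (suc n) (begin
  (1 + n) * (2 * 2 ^ n)         ≤⟨ *-monoʳ-≤ (1 + n) (*-monoʳ-≤ 2 (2^n≤central n)) ⟩
  (1 + n) * (2 * central n)     ≡⟨ swap n (central n) ⟩
  2 * (1 + n) * central n       ≤⟨ *-monoˡ-≤ (central n) (*-monoʳ-≤ 2 (s≤s (m≤m+n n n))) ⟩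
  2 * (1 + (n + n)) * central n ≡⟨ [n+1]*central[n+1]≡2*[2n+1]*central[n] n ⟨
  (1 + n) * central (1 + n)     ∎)
  where
  open ≤-Reasoning
  swap : ∀ n x → (1 + n) * (2 * x) ≡ 2 * (1 + n) * x
  swap = solve-∀

-- Invariant of the recursion above, since 4 (2n+1)² (4n+5) = 16 (n+1)² (4n+1) + 4.
16^n≤central²*[4n+1] : ∀ n → 16 ^ n ≤ central n * central n * (1 + 4 * n)
16^n≤central²*[4n+1] zero    = ≤-refl
16^n≤central²*[4n+1] (suc n) = *-cancelʳ-≤ _ _ F (begin
  16 * 16 ^ n * F                                     ≡⟨ swap (16 ^ n) F ⟩
  16 * F * 16 ^ n                                     ≤⟨ *-monoˡ-≤ (16 ^ n) (m≤m+n (16 * F) 4) ⟩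
  (16 * F + 4) * 16 ^ n                               ≡⟨ cong (_* 16 ^ n) (expand n) ⟩
  G * 16 ^ n                                          ≤⟨ *-monoʳ-≤ G (16^n≤central²*[4n+1] n) ⟩
  G * (c * c * (1 + 4 * n))                           ≡⟨ regroup n c ⟩
  2 * (1 + (n + n)) * c * (2 * (1 + (n + n)) * c) * H ≡⟨ cong (λ x → x * x * H) recursion ⟨
  (1 + n) * c′ * ((1 + n) * c′) * H                   ≡⟨ regroup′ n c′ ⟩
  c′ * c′ * (1 + 4 * (1 + n)) * F                     ∎)
  where
  open ≤-Reasoning
  c  = central n
  c′ = central (suc n)
  recursion : (1 + n) * c′ ≡ 2 * (1 + (n + n)) * c
  recursion = [n+1]*central[n+1]≡2*[2n+1]*central[n] n
  F = (1 + n) * (1 + n) * (1 + 4 * n)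
  G = 4 * ((1 + (n + n)) * (1 + (n + n)) * (5 + 4 * n))
  H = (5 + 4 * n) * (1 + 4 * n)
  swap : ∀ x f → 16 * x * f ≡ 16 * f * x
  swap = solve-∀
  expand : ∀ n → 16 * ((1 + n) * (1 + n) * (1 + 4 * n)) + 4 ≡ 4 * ((1 + (n + n)) * (1 + (n + n)) * (5 + 4 * n))
  expand = solve-∀
  regroup : ∀ n x → 4 * ((1 + (n + n)) * (1 + (n + n)) * (5 + 4 * n)) * (x * x * (1 + 4 * n))
                  ≡ 2 * (1 + (n + n)) * x * (2 * (1 + (n + n)) * x) * ((5 + 4 * n) * (1 + 4 * n))
  regroup = solve-∀
  regroup′ : ∀ n x → (1 + n) * x * ((1 + n) * x) * ((5 + 4 * n) * (1 + 4 * n))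
                   ≡ x * x * (1 + 4 * (1 + n)) * ((1 + n) * (1 + n) * (1 + 4 * n))
  regroup′ = solve-∀

m*m≤n*n⇒m≤n : ∀ {m n} → m * m ≤ n * n → m ≤ n
m*m≤n*n⇒m≤n m*m≤n*n = ≮⇒≥ λ n<m → <⇒≱ (*-mono-< n<m n<m) m*m≤n*n

2^[2+2n]≤n*central : ∀ {n} → 65 ≤ n → 2 ^ (2 + (n + n)) ≤ n * central n
2^[2+2n]≤n*central {n} 65≤n = m*m≤n*n⇒m≤n (begin
  2 ^ (2 + (n + n)) * 2 ^ (2 + (n + n))         ≡⟨ ^-distribˡ-+-* 2 (2 + (n + n)) _ ⟨
  2 ^ (2 + (n + n) + (2 + (n + n)))             ≡⟨ cong (2 ^_) (double n) ⟩
  2 ^ (4 * (1 + n))                             ≡⟨ ^-*-assoc 2 4 (1 + n) ⟨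
  16 * 16 ^ n                                   ≤⟨ *-cancelʳ-≤ _ _ (1 + 4 * n) (begin
    16 * 16 ^ n * (1 + 4 * n)                     ≡⟨ swap (16 ^ n) n ⟩
    16 * (1 + 4 * n) * 16 ^ n                     ≤⟨ *-monoˡ-≤ (16 ^ n) 16*[1+4n]≤n*n ⟩
    n * n * 16 ^ n                                ≤⟨ *-monoʳ-≤ (n * n) (16^n≤central²*[4n+1] n) ⟩
    n * n * (central n * central n * (1 + 4 * n)) ≡⟨ regroup n (central n) ⟩
    n * central n * (n * central n) * (1 + 4 * n) ∎) ⟩
  n * central n * (n * central n)               ∎)
  where
  open ≤-Reasoning
  double : ∀ n → 2 + (n + n) + (2 + (n + n)) ≡ 4 * (1 + n)
  double = solve-∀
  swap : ∀ x n → 16 * x * (1 + 4 * n) ≡ 16 * (1 + 4 * n) * x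
  swap = solve-∀
  regroup : ∀ n x → n * n * (x * x * (1 + 4 * n)) ≡ n * x * (n * x) * (1 + 4 * n)
  regroup = solve-∀
  expand : ∀ m → 16 * (1 + 4 * (65 + m)) + (49 + 66 * m + m * m) ≡ (65 + m) * (65 + m)
  expand = solve-∀
  16*[1+4n]≤n*n : 16 * (1 + 4 * n) ≤ n * n
  16*[1+4n]≤n*n = subst (λ m → 16 * (1 + 4 * m) ≤ m * m) (m+[n∸m]≡n 65≤n)
    (≤-trans (m≤m+n _ _) (≤-reflexive (expand (n ∸ 65))))

nCk≤[1+n]Ck : ∀ n k → n C k ≤ suc n C k
nCk≤[1+n]Ck n zero    = ≤-refl
nCk≤[1+n]Ck n (suc k) = ≤-trans (m≤n+m _ _) (≤-reflexive (nCk+nC[k+1]≡[n+1]C[k+1] n k))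

C-monoˡ-≤ : ∀ k {m n} → m ≤ n → m C k ≤ n C k
C-monoˡ-≤ k m≤n = go (≤⇒≤′ m≤n)
  where
  go : ∀ {m n} → m ≤′ n → m C k ≤ n C k
  go ≤′-refl        = ≤-refl
  go (≤′-step m≤′n) = ≤-trans (go m≤′n) (nCk≤[1+n]Ck _ k)

⌊n/2⌋+⌊n/2⌋≤n : ∀ n → ⌊ n /2⌋ + ⌊ n /2⌋ ≤ n
⌊n/2⌋+⌊n/2⌋≤n n = ≤-trans (+-monoʳ-≤ ⌊ n /2⌋ (⌊n/2⌋≤⌈n/2⌉ n)) (≤-reflexive (⌊n/2⌋+⌈n/2⌉≡n n))

n≤1+⌊n/2⌋+⌊n/2⌋ : ∀ n → n ≤ suc (⌊ n /2⌋ + ⌊ n /2⌋)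
n≤1+⌊n/2⌋+⌊n/2⌋ zero          = z≤n
n≤1+⌊n/2⌋+⌊n/2⌋ (suc zero)    = ≤-refl
n≤1+⌊n/2⌋+⌊n/2⌋ (suc (suc n)) =
  ≤-trans (s≤s (s≤s (n≤1+⌊n/2⌋+⌊n/2⌋ n))) (≤-reflexive (cong (2 +_) (sym (+-suc ⌊ n /2⌋ ⌊ n /2⌋))))

m^m≤n^n : ∀ {m n} → m ≤ n → m ^ m ≤ n ^ n
m^m≤n^n {n = zero}  z≤n = ≤-refl
m^m≤n^n {m} {suc n} m≤n = ≤-trans (^-monoˡ-≤ m m≤n) (^-monoʳ-≤ (suc n) m≤n)

2^m<N^N : ∀ {n m N} → 2 ^ n ≤ N → m < n * N → 2 ^ m < N ^ N
2^m<N^N {n} {m} {N} 2^n≤N m<n*N = begin-strict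
  2 ^ m       <⟨ ^-monoʳ-< 2 ≤-refl m<n*N ⟩
  2 ^ (n * N) ≡⟨ ^-*-assoc 2 n N ⟨
  (2 ^ n) ^ N ≤⟨ ^-monoˡ-≤ N 2^n≤N ⟩
  N ^ N       ∎
  where open ≤-Reasoning

middleBinomial : ℕ → ℕ
middleBinomial b = b C ⌊ b /2⌋

TowerWitness : ℕ → ℕ → Set
TowerWitness b n = 2 ^ n ≤ suc (middleBinomial b) × 2 ^ suc b < n * suc (middleBinomial b)

towerWitness? : ∀ b n → Dec (TowerWitness b n)
towerWitness? b n = 2 ^ n ≤? suc (middleBinomial b) ×-dec 2 ^ suc b <? n * suc (middleBinomial b)

towerWitness-large : ∀ {b} → 130 ≤ b → TowerWitness b ⌊ b /2⌋
towerWitness-large {b} 130≤b = 2^h≤D+1 , 2^[1+b]<h*[D+1]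
  where
  open ≤-Reasoning
  h = ⌊ b /2⌋
  D = middleBinomial b
  65≤h : 65 ≤ h
  65≤h = ⌊n/2⌋-mono 130≤b
  central≤D : central h ≤ D
  central≤D = C-monoˡ-≤ h (⌊n/2⌋+⌊n/2⌋≤n b)
  2^h≤D+1 : 2 ^ h ≤ suc D
  2^h≤D+1 = m≤n⇒m≤1+n (≤-trans (2^n≤central h) central≤D)
  2^[1+b]<h*[D+1] : 2 ^ suc b < h * suc D
  2^[1+b]<h*[D+1] = begin-strict
    2 ^ suc b         ≤⟨ ^-monoʳ-≤ 2 (s≤s (n≤1+⌊n/2⌋+⌊n/2⌋ b)) ⟩
    2 ^ (2 + (h + h)) ≤⟨ 2^[2+2n]≤n*central 65≤h ⟩
    h * central h     ≤⟨ *-monoʳ-≤ h central≤D ⟩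
    h * D             <⟨ *-monoʳ-< h {{>-nonZero (≤-trans (s≤s z≤n) 65≤h)}} (n<1+n D) ⟩
    h * suc D         ∎

-- Since log₂ (middleBinomial b) ≈ b − ½ log₂ b, one of b − 3 and b − 4 works in this range.
towerWitness-small : All (λ b → 12 ≤ b → TowerWitness b (b ∸ 3) ⊎ TowerWitness b (b ∸ 4)) (upTo 130)
towerWitness-small = toWitness {a? = all? decide (upTo 130)} tt
  where
  decide : ∀ b → Dec (12 ≤ b → TowerWitness b (b ∸ 3) ⊎ TowerWitness b (b ∸ 4))
  decide b = 12 ≤? b →-dec (towerWitness? b (b ∸ 3) ⊎-dec towerWitness? b (b ∸ 4))

towerWitness⇒ : ∀ b n → TowerWitness b n → 2 ^ 2 ^ suc b < suc (middleBinomial b) ^ suc (middleBinomial b)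
towerWitness⇒ _ n (2^n≤N , m<n*N) = 2^m<N^N {n} 2^n≤N m<n*N

2^2^[1+b]<[1+D]^[1+D] : ∀ b → 11 ≤ b → 2 ^ 2 ^ suc b < suc (middleBinomial b) ^ suc (middleBinomial b)
2^2^[1+b]<[1+D]^[1+D] b 11≤b with m≤n⇒m<n∨m≡n 11≤b
... | inj₂ refl = toWitness {a? = 2 ^ 2 ^ 12 <? 463 ^ 463} tt  -- no witness exists for b = 11
... | inj₁ 12≤b with b <? 130
...   | yes b<130 = [ towerWitness⇒ b (b ∸ 3) , towerWitness⇒ b (b ∸ 4) ]′
                      (All.lookup towerWitness-small (∈-upTo⁺ b<130) 12≤b)
...   | no  b≮130 = towerWitness⇒ b ⌊ b /2⌋ (towerWitness-large (≮⇒≥ b≮130))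

Antichain : ℕ → ℕ → Set
Antichain k b = Σ (Fin k → Subset b) λ α → ∀ x y → α x ⊆ α y → x ≡ y

p⊆q∧∣q∣≤∣p∣⇒p≡q : ∀ {n} {p q : Subset n} → p ⊆ q → ∣ q ∣ ≤ ∣ p ∣ → p ≡ q
p⊆q∧∣q∣≤∣p∣⇒p≡q {p = []}          {[]}          _   _ = refl
p⊆q∧∣q∣≤∣p∣⇒p≡q {p = outside ∷ p} {outside ∷ q} p⊆q ∣q∣≤∣p∣ =
  cong (outside ∷_) (p⊆q∧∣q∣≤∣p∣⇒p≡q (drop-∷-⊆ p⊆q) ∣q∣≤∣p∣)
p⊆q∧∣q∣≤∣p∣⇒p≡q {p = inside  ∷ p} {inside  ∷ q} p⊆q ∣q∣≤∣p∣ =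
  cong (inside ∷_) (p⊆q∧∣q∣≤∣p∣⇒p≡q (drop-∷-⊆ p⊆q) (≤-pred ∣q∣≤∣p∣))
p⊆q∧∣q∣≤∣p∣⇒p≡q {p = outside ∷ p} {inside  ∷ q} p⊆q ∣q∣≤∣p∣ =
  contradiction (≤-trans ∣q∣≤∣p∣ (p⊆q⇒∣p∣≤∣q∣ (drop-∷-⊆ p⊆q))) 1+n≰n
p⊆q∧∣q∣≤∣p∣⇒p≡q {p = inside  ∷ p} {outside ∷ q} p⊆q _ with () ← p⊆q here

pascalSplit : ∀ b w → Fin (suc b C suc w) → Fin (b C w) ⊎ Fin (b C suc w)
pascalSplit b w = splitAt (b C w) ∘ subst Fin (sym (nCk+nC[k+1]≡[n+1]C[k+1] b w))

pascalSplit-injective : ∀ b w {i j} → pascalSplit b w i ≡ pascalSplit b w j → i ≡ j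
pascalSplit-injective b w eq = subst-injective {P = Fin} (sym (nCk+nC[k+1]≡[n+1]C[k+1] b w))
  (trans (sym (join-splitAt (b C w) (b C suc w) _)) (trans (cong (join _ _) eq) (join-splitAt (b C w) (b C suc w) _)))

subsetOfSize : ∀ b w → Fin (b C w) → Subset b
subsetOfSize zero    zero    _ = []
subsetOfSize (suc b) zero    _ = ⊥
subsetOfSize (suc b) (suc w)   =
  [ (inside ∷_) ∘ subsetOfSize b w , (outside ∷_) ∘ subsetOfSize b (suc w) ]′ ∘ pascalSplit b w

∣subsetOfSize∣ : ∀ b w i → ∣ subsetOfSize b w i ∣ ≡ w
∣subsetOfSize∣ zero    zero    _ = refl
∣subsetOfSize∣ (suc b) zero    _ = ∣⊥∣≡0 (suc b)
∣subsetOfSize∣ (suc b) (suc w) i with pascalSplit b w i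
... | inj₁ j = cong suc (∣subsetOfSize∣ b w j)
... | inj₂ j = ∣subsetOfSize∣ b (suc w) j

subsetOfSize-injective : ∀ b w {i j} → subsetOfSize b w i ≡ subsetOfSize b w j → i ≡ j
subsetOfSize-injective zero    zero    {zero} {zero} _ = refl
subsetOfSize-injective (suc b) zero    {zero} {zero} _ = refl
subsetOfSize-injective (suc b) (suc w) {i} {j} eq =
  pascalSplit-injective b w (cases (pascalSplit b w i) (pascalSplit b w j) eq)
  where
  cases : ∀ x y →
    [ (inside ∷_) ∘ subsetOfSize b w , (outside ∷_) ∘ subsetOfSize b (suc w) ]′ x ≡
    [ (inside ∷_) ∘ subsetOfSize b w , (outside ∷_) ∘ subsetOfSize b (suc w) ]′ y → x ≡ y
  cases (inj₁ x) (inj₁ y) e = cong inj₁ (subsetOfSize-injective b w (∷-injectiveʳ e))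
  cases (inj₂ x) (inj₂ y) e = cong inj₂ (subsetOfSize-injective b (suc w) (∷-injectiveʳ e))
  cases (inj₁ x) (inj₂ y) e with () ← ∷-injectiveˡ e
  cases (inj₂ x) (inj₁ y) e with () ← ∷-injectiveˡ e

antichain : ∀ {k} b w → k ≤ b C w → Antichain k b
antichain {k} b w k≤bCw = α , α-antichain
  where
  α : Fin k → Subset b
  α x = subsetOfSize b w (inject≤ x k≤bCw)
  α-antichain : ∀ x y → α x ⊆ α y → x ≡ y
  α-antichain x y αx⊆αy = inject≤-injective k≤bCw k≤bCw x y (subsetOfSize-injective b w αx≡αy)
    where
    αx≡αy : α x ≡ α y
    αx≡αy = p⊆q∧∣q∣≤∣p∣⇒p≡q αx⊆αy (≤-reflexive (trans (∣subsetOfSize∣ b w _) (sym (∣subsetOfSize∣ b w _))))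

⊆-++⁺ : ∀ {m n} {p q : Subset m} {p′ q′ : Subset n} → p ⊆ q → p′ ⊆ q′ → p ++ p′ ⊆ q ++ q′
⊆-++⁺ {p = []}    {[]}    _   p′⊆q′ = p′⊆q′
⊆-++⁺ {p = _ ∷ _} {_ ∷ _} p⊆q p′⊆q′ here with here ← p⊆q here = here
⊆-++⁺ {p = _ ∷ _} {_ ∷ _} p⊆q p′⊆q′ (there x∈p++p′) = there (⊆-++⁺ (drop-∷-⊆ p⊆q) p′⊆q′ x∈p++p′)

⊆-++⁻ˡ : ∀ {m n} {p q : Subset m} {p′ q′ : Subset n} → p ++ p′ ⊆ q ++ q′ → p ⊆ q
⊆-++⁻ˡ {p = _ ∷ _} {_ ∷ _} p++p′⊆q++q′ here with here ← p++p′⊆q++q′ here = here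
⊆-++⁻ˡ {p = _ ∷ _} {_ ∷ _} p++p′⊆q++q′ (there x∈p) = there (⊆-++⁻ˡ (drop-∷-⊆ p++p′⊆q++q′) x∈p)

⊆-++⁻ʳ : ∀ {m n} {p q : Subset m} {p′ q′ : Subset n} → p ++ p′ ⊆ q ++ q′ → p′ ⊆ q′
⊆-++⁻ʳ {p = []}    {[]}    p++p′⊆q++q′ = p++p′⊆q++q′
⊆-++⁻ʳ {p = _ ∷ _} {_ ∷ _} p++p′⊆q++q′ = ⊆-++⁻ʳ (drop-∷-⊆ p++p′⊆q++q′)

module _ {k : ℕ} where

  ∈-underlying⁺ : ∀ {x : Fin k} {xs} → x ∈ xs → x Subset.∈ underlying xs
  ∈-underlying⁺ {xs = y ∷ ys} (here refl) = p⊆p∪q (underlying ys) (x∈⁅x⁆ y)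
  ∈-underlying⁺ {xs = y ∷ ys} (there x∈ys) = q⊆p∪q ⁅ y ⁆ (underlying ys) (∈-underlying⁺ x∈ys)

  ∈-underlying⁻ : ∀ {x : Fin k} {xs} → x Subset.∈ underlying xs → x ∈ xs
  ∈-underlying⁻ {xs = []} x∈⊥ = contradiction x∈⊥ ∉⊥
  ∈-underlying⁻ {xs = y ∷ ys} x∈xs with x∈p∪q⁻ ⁅ y ⁆ (underlying ys) x∈xs
  ... | inj₁ x∈⁅y⁆ = here (x∈⁅y⁆⇒x≡y y x∈⁅y⁆)
  ... | inj₂ x∈ys  = there (∈-underlying⁻ x∈ys)

  underlying-mono : ∀ {xs ys : List (Fin k)} → xs List.⊆ ys → underlying xs ⊆ underlying ys
  underlying-mono xs⊆ys = ∈-underlying⁺ ∘ xs⊆ys ∘ ∈-underlying⁻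

  underlying-mono⁻ : ∀ {xs ys : List (Fin k)} → underlying xs ⊆ underlying ys → xs List.⊆ ys
  underlying-mono⁻ uxs⊆uys = ∈-underlying⁻ ∘ uxs⊆uys ∘ ∈-underlying⁺

  lookup-injective : ∀ {xs : List (Fin k)} → Unique xs → ∀ i j → lookup xs i ≡ lookup xs j → i ≡ j
  lookup-injective (_ ∷ _)     zero    zero    _  = refl
  lookup-injective (x∉xs ∷ _)  zero    (suc j) eq = contradiction eq (All.lookup x∉xs (∈-lookup j))
  lookup-injective (x∉xs ∷ _)  (suc i) zero    eq = contradiction (sym eq) (All.lookup x∉xs (∈-lookup i))
  lookup-injective (_ ∷ uxs)   (suc i) (suc j) eq = cong suc (lookup-injective uxs i j eq)

  Unique⇒length≤ : ∀ {xs : List (Fin k)} → Unique xs → length xs ≤ k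
  Unique⇒length≤ {xs} uxs = ≮⇒≥ λ k<len →
    let i , j , i<j , eq = pigeonhole k<len (lookup xs)
    in <⇒≢ i<j (cong toℕ (lookup-injective uxs i j eq))

prefix-antisym : ∀ {A : Set} {xs ys us vs : List A} → xs List.++ us ≡ ys → ys List.++ vs ≡ xs → xs ≡ ys
prefix-antisym {xs = xs} {us = us} {vs} refl xs++us++vs≡xs = begin
  xs              ≡⟨ ++-identityʳ xs ⟨
  xs List.++ []   ≡⟨ cong (xs List.++_) us≡[] ⟨
  xs List.++ us   ∎
  where
  open ≡-Reasoning
  us≡[] : us ≡ []
  us≡[] = ++-conicalˡ us vs (++-identityʳ-unique xs (sym (trans (sym (++-assoc xs us vs)) xs++us++vs≡xs)))

module Blocks {k b} (α : Fin k → Subset b) (α-antichain : ∀ x y → α x ⊆ α y → x ≡ y) where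

  blocks : ∀ n → List (Fin k) → Subset (n * b)
  blocks (suc n) (x ∷ xs) = α x ++ blocks n xs
  blocks _       _        = ⊥

  blocks-++ : ∀ n xs ys → blocks n xs ⊆ blocks n (xs List.++ ys)
  blocks-++ zero    xs       ys = ⊥⊆
  blocks-++ (suc n) []       ys = ⊥⊆
  blocks-++ (suc n) (x ∷ xs) ys = ⊆-++⁺ ⊆-refl (blocks-++ n xs ys)

  -- xs ⊆ ys is needed when ys is shorter: its missing blocks are empty, and α may take the value ∅.
  blocks-⊆⇒prefix : ∀ n {xs ys} → Unique xs → length xs ≤ n → xs List.⊆ ys →
                    blocks n xs ⊆ blocks n ys → ∃ λ zs → xs List.++ zs ≡ ys
  blocks-⊆⇒prefix n       {[]}     {ys}     _ _ _ _ = ys , refl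
  blocks-⊆⇒prefix (suc n) {x ∷ xs} {[]}     _ _ xs⊆ys _ with () ← xs⊆ys (here refl)
  blocks-⊆⇒prefix (suc n) {x ∷ xs} {y ∷ ys} (x∉xs ∷ uxs) (s≤s len≤n) x∷xs⊆y∷ys bxs⊆bys
    with refl ← α-antichain x y (⊆-++⁻ˡ bxs⊆bys) =
    let zs , xs++zs≡ys = blocks-⊆⇒prefix n uxs len≤n xs⊆ys (⊆-++⁻ʳ bxs⊆bys)
    in zs , cong (x ∷_) xs++zs≡ys
    where
    xs⊆ys : xs List.⊆ ys
    xs⊆ys z∈xs with x∷xs⊆y∷ys (there z∈xs)
    ... | here refl = contradiction refl (All.lookup x∉xs z∈xs)
    ... | there z∈ys = z∈ys

  module _ (d : ℕ) where

    τ : OrdSub k → QSet (k * b + d) k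
    τ (xs , _) = blocks k xs ++ ⊥ , underlying xs

    prefix⇒τ-⊆ : ∀ S T → S ≤O T → τ S ⊆Q τ T
    prefix⇒τ-⊆ (xs , _) _ (ys , refl) =
      ⊆-++⁺ (blocks-++ k xs ys) ⊆-refl , underlying-mono (xs⊆xs++ys xs ys)

    τ-⊆⇒prefix : ∀ S T → τ S ⊆Q τ T → S ≤O T
    τ-⊆⇒prefix (xs , uxs) _ (bxs⊆bys , uxs⊆uys) =
      blocks-⊆⇒prefix k uxs (Unique⇒length≤ uxs) (underlying-mono⁻ uxs⊆uys) (⊆-++⁻ˡ bxs⊆bys)

    τ-injective : ∀ S T → τ S ≡ τ T → proj₁ S ≡ proj₁ T
    τ-injective S T τS≡τT =
      prefix-antisym (proj₂ (τ-⊆⇒prefix S T (≡⇒⊆Q τS≡τT))) (proj₂ (τ-⊆⇒prefix T S (≡⇒⊆Q (sym τS≡τT))))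
      where
      ≡⇒⊆Q : ∀ {X Y : QSet (k * b + d) k} → X ≡ Y → X ⊆Q Y
      ≡⇒⊆Q refl = ⊆-refl , ⊆-refl

    τ-shrub : IsShrubEmbedding (k * b + d) k τ
    τ-shrub = τ-injective , (λ S T → mk⇔ (prefix⇒τ-⊆ S T) (τ-⊆⇒prefix S T)) , λ _ → refl

antichain⇒shrub : ∀ {k b a} → Antichain k b → k * b ≤ a → HasShrub a k
antichain⇒shrub {k} {b} {a} (α , α-antichain) k*b≤a =
  subst (λ a → HasShrub a k) (m+[n∸m]≡n k*b≤a) (τ (a ∸ k * b) , τ-shrub (a ∸ k * b))
  where open Blocks α α-antichain

logLogBound⇒ : ∀ {k a} → LogLogBound k a → ∀ c → 2 ^ 2 ^ c < k ^ k → c * k < a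
logLogBound⇒ {k} {a} hyp c 2^2^c<k^k = ≰⇒> λ a≤c*k → <⇒≱ 2^[c*k]<2^a (^-monoʳ-≤ 2 a≤c*k)
  where
  [2^c]^k<2^a*1^k : (2 ^ c) ^ k < 2 ^ a * 1 ^ k
  [2^c]^k<2^a*1^k = hyp (2 ^ c) 1 ≤-refl (subst (λ e → 2 ^ 2 ^ c < k ^ e) (sym (*-identityʳ k)) 2^2^c<k^k)
  2^[c*k]<2^a : 2 ^ (c * k) < 2 ^ a
  2^[c*k]<2^a = subst₂ _<_ (^-*-assoc 2 c k) (trans (cong (2 ^ a *_) (^-zeroˡ k)) (*-identityʳ (2 ^ a)))
                       [2^c]^k<2^a*1^k

k≤middleBinomial : ∀ {k a b} → LogLogBound k a → 11 ≤ b → a < suc b * k → k ≤ middleBinomial b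
k≤middleBinomial {k} {a} {b} hyp 11≤b a<[1+b]*k = ≮⇒≥ λ D<k →
  <-asym a<[1+b]*k (logLogBound⇒ hyp (suc b) (<-≤-trans (2^2^[1+b]<[1+D]^[1+D] b 11≤b) (m^m≤n^n D<k)))

blockWidth : ∀ {k a} → SizeHyp k a → ∃ λ b → k * b ≤ a × k ≤ middleBinomial b
blockWidth {zero}      _                  = 0 , z≤n , z≤n
blockWidth {k@(suc _)} {a} (hyp , k*11≤a) = a / k , k*b≤a , k≤middleBinomial hyp 11≤b a<[1+b]*k
  where
  k*b≤a : k * (a / k) ≤ a
  k*b≤a = subst (_≤ a) (*-comm (a / k) k) (m/n*n≤m a k)
  a<[1+b]*k : a < suc (a / k) * k
  a<[1+b]*k = subst (_< suc (a / k) * k) (sym (m≡m%n+[m/n]*n a k)) (+-monoˡ-< ((a / k) * k) (m%n<n a k))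
  11≤b : 11 ≤ a / k
  11≤b = subst (_≤ a / k) (m*n/n≡m 11 k) (/-monoˡ-≤ k (subst (_≤ a) (*-comm k 11) k*11≤a))

proposition11 : (k a : ℕ) → SizeHyp k a → HasShrub a k
proposition11 k a hyp =
  let b , k*b≤a , k≤D = blockWidth hyp
  in antichain⇒shrub (antichain b ⌊ b /2⌋ k≤D) k*b≤a
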